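{- Let $N_2$ be a positive rational number and let $(X_2,Y_2)$ and $(Z_2,W_2)$ be rational points on the curve $C_{N_2}: y^2=x^3-N_2^2x$ with $Y_2\neq 0$, $W_2\neq 0$, $X_2\neq Z_2$, and such that $X_2Z_2$ is the square of a rational number; let $\sqrt{X_2Z_2}$ denote its positive square root. (i) For every positive rational number $a'$, the numbers $$b'=\Big|\frac{2Y_2W_2}{N_2(Z_2^2-X_2^2)}\Big|\,a',\quad c'=\Big|\frac{Y_2W_2}{N_2(X_2+Z_2)\sqrt{X_2Z_2}}\Big|\,a',\quad d_{bc}'=\Big|\frac{Y_2W_2}{N_2(Z_2-X_2)\sqrt{X_2Z_2}}\Big|\,a',$$ $$d_{ac}'=\frac{X_2Z_2+N_2^2}{|N_2(X_2+Z_2)|}\,a',\quad d_s'=\Big|\frac{X_2Z_2-N_2^2}{N_2(Z_2-X_2)}\Big|\,a'$$ are positive rational numbers and $(a',b',c',d_{bc}',d_{ac}',d_s')$ is a nearly-perfect cuboid; its face diagonal $d_{ab}'=\sqrt{a'^2+b'^2}$ equals $\sqrt{1+\Big(\frac{2Y_2W_2}{N_2(Z_2^2-X_2^2)}\Big)^2}\cdot a'$. (ii) Conversely, every nearly-perfect cuboid is obtained in this way for some such $N_2$, $(X_2,Y_2)$, $(Z_2,W_2)$ and $a'$. (iii) In particular, a perfect cuboid exists if and only if for some such data the number $\sqrt{1+\Big(\frac{2Y_2W_2}{N_2(Z_2^2-X_2^2)}\Big)^2}\cdot a'$ is rational.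
   Context: For a nonzero rational $N$, the congruent number curve is $C_N: y^2=x^3-N^2x$; a rational point $(x,y)$ on it is called nontrivial if $y\neq 0$. A nearly-perfect cuboid (NPC) here means a sextuple of positive rational numbers $(a,b,c,d_{bc},d_{ac},d_s)$ with $b^2+c^2=d_{bc}^2$, $a^2+c^2=d_{ac}^2$, $a^2+b^2+c^2=d_s^2$ (the remaining face diagonal $d_{ab}=\sqrt{a^2+b^2}$ may be irrational). A perfect cuboid is a triple of positive rationals $a,b,c$ such that $a^2+b^2$, $b^2+c^2$, $a^2+c^2$ and $a^2+b^2+c^2$ are all squares of rational numbers. -}

module Defs where

open import Data.Rational using (ℚ; 0ℚ; 1ℚ; _+_; _*_; _-_; -_; _<_; ∣_∣; 1/_; ≢-nonZero)
open import Data.Rational.Properties using (_≟_)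
open import Data.Product using (Σ; ∃; _×_; _,_)
open import Relation.Nullary using (¬_; yes; no)
open import Relation.Binary.PropositionalEquality using (_≡_)

-- Total reciprocal/division on ℚ (convention: q / 0 = 0).  In the
-- theorem below every denominator is provably nonzero under the hypotheses.
inv : ℚ → ℚ
inv q with q ≟ 0ℚ
... | yes _ = 0ℚ
... | no q≢0 = 1/_ q {{≢-nonZero q≢0}}

infixl 7 _/'_
_/'_ : ℚ → ℚ → ℚ
p /' q = p * inv q

2ℚ : ℚ
2ℚ = 1ℚ + 1ℚ

sq : ℚ → ℚ
sq q = q * q

OnCN : ℚ → ℚ → ℚ → Set
OnCN N x y = y * y ≡ x * x * x - N * N * x

Admissible : ℚ → ℚ → ℚ → ℚ → ℚ → ℚ → Set
Admissible N X Y Z W s =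
  (0ℚ < N) × OnCN N X Y × OnCN N Z W ×
  ¬ (Y ≡ 0ℚ) × ¬ (W ≡ 0ℚ) × ¬ (X ≡ Z) ×
  (s * s ≡ X * Z) × (0ℚ < s)

IsNPC : ℚ → ℚ → ℚ → ℚ → ℚ → ℚ → Set
IsNPC a b c dbc dac ds =
  (0ℚ < a) × (0ℚ < b) × (0ℚ < c) × (0ℚ < dbc) × (0ℚ < dac) × (0ℚ < ds) ×
  (b * b + c * c ≡ dbc * dbc) ×
  (a * a + c * c ≡ dac * dac) ×
  (a * a + b * b + c * c ≡ ds * ds)

IsRationalSquare : ℚ → Set
IsRationalSquare q = ∃ λ r → r * r ≡ q

PerfectCuboid : ℚ → ℚ → ℚ → Set
PerfectCuboid a b c =
  (0ℚ < a) × (0ℚ < b) × (0ℚ < c) ×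
  IsRationalSquare (a * a + b * b) × IsRationalSquare (b * b + c * c) ×
  IsRationalSquare (a * a + c * c) × IsRationalSquare (a * a + b * b + c * c)

kRatio : ℚ → ℚ → ℚ → ℚ → ℚ → ℚ
kRatio N X Y Z W = (2ℚ * Y * W) /' (N * (Z * Z - X * X))

b′ : ℚ → ℚ → ℚ → ℚ → ℚ → ℚ → ℚ → ℚ
b′ N X Y Z W s a = ∣ kRatio N X Y Z W ∣ * a

c′ : ℚ → ℚ → ℚ → ℚ → ℚ → ℚ → ℚ → ℚ
c′ N X Y Z W s a = ∣ (Y * W) /' (N * (X + Z) * s) ∣ * a

dbc′ : ℚ → ℚ → ℚ → ℚ → ℚ → ℚ → ℚ → ℚ
dbc′ N X Y Z W s a = ∣ (Y * W) /' (N * (Z - X) * s) ∣ * a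

dac′ : ℚ → ℚ → ℚ → ℚ → ℚ → ℚ → ℚ → ℚ
dac′ N X Y Z W s a = ((X * Z + N * N) /' ∣ N * (X + Z) ∣) * a

ds′ : ℚ → ℚ → ℚ → ℚ → ℚ → ℚ → ℚ → ℚ
ds′ N X Y Z W s a = ∣ (X * Z - N * N) /' (N * (Z - X)) ∣ * a

{-# OPTIONS --safe #-}
module Submission where

-- (i) Write K, C, E, F, G for the ratios with b′ = |K| a′, c′ = |C| a′, ….  Clearing denominators and
-- using Y²W² = XZ (X² − N²)(Z² − N²) and s² = XZ turns K² + C² = E², 1 + C² = F² and F² + K² = G²
-- into polynomial identities, so (1, |K|, |C|, |E|, F, |G|) is an NPC, and NPCs scale.
-- (ii) For an NPC put D = d_ac d_bc − d_s c, P = a (d_bc + c), Q = a (d_bc − c).  The NPC equations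
-- give PQ = (ab)², (ab)² + D² = 2 d_ac d_bc D and (ab)² − D² = 2 d_s c D, i.e. for p = P/D, q = Q/D
-- d_ac/a = (pq + 1)/(p + q) and d_s/a = (pq − 1)/(p − q).  With N = p (p² − 1) the point (Np, N²)
-- lies on C_N, and so does a point with x = Nq because pq (p² − 1)(q² − 1) = (2abc d_bc / D²)²;
-- moreover 0 < D < P makes N positive.
-- (iii) follows from a′² + b′² = (1 + K²) a′².

open import Defs
open import Data.List using ([]; _∷_)
open import Data.Product using (∃; _×_; _,_; proj₂)
open import Data.Rational using (ℚ; 0ℚ; 1ℚ; _+_; _*_; _-_; -_; _<_; _≤_; ∣_∣; ≢-nonZero; positive; nonNegative)
open import Data.Rational.Properties
open import Algebra.Properties.Group +-0-group using (x∙y⁻¹≈ε⇒x≈y)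
open import Data.Sum using (inj₁; inj₂)
open import Function.Bundles using (_⇔_; mk⇔)
open import Level using (0ℓ)
open import Relation.Binary.Definitions using (tri<; tri≈; tri>)
open import Relation.Binary.PropositionalEquality
open import Relation.Nullary using (Dec; yes; no; contradiction)
open import Relation.Nullary.Decidable using (dec⇒maybe)
open import Tactic.RingSolver using (solve-∀; solve)
import Tactic.RingSolver.Core.AlmostCommutativeRing as ACR

open ≡-Reasoning

ℚ-ring : ACR.AlmostCommutativeRing 0ℓ 0ℓ
ℚ-ring = ACR.fromCommutativeRing +-*-commutativeRing λ x → dec⇒maybe (0ℚ ≟ x)

square-* : ∀ x y → (x * y) * (x * y) ≡ (x * x) * (y * y)
square-* = solve-∀ ℚ-ring

neg-*-neg : ∀ x y → - x * - y ≡ x * y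
neg-*-neg = solve-∀ ℚ-ring

x²-y²≡[x-y][x+y] : ∀ x y → x * x - y * y ≡ (x - y) * (x + y)
x²-y²≡[x-y][x+y] = solve-∀ ℚ-ring

inv-inverseˡ : ∀ {q} → q ≢ 0ℚ → inv q * q ≡ 1ℚ
inv-inverseˡ {q} q≢0 with q ≟ 0ℚ
... | yes q≡0 = contradiction q≡0 q≢0
... | no  q≢0′ = *-inverseˡ q {{≢-nonZero q≢0′}}

inv-inverseʳ : ∀ {q} → q ≢ 0ℚ → q * inv q ≡ 1ℚ
inv-inverseʳ {q} q≢0 = trans (*-comm q (inv q)) (inv-inverseˡ q≢0)

/'-*-cancel : ∀ p {q} → q ≢ 0ℚ → (p /' q) * q ≡ p
/'-*-cancel p {q} q≢0 = begin
  p * inv q * q    ≡⟨ *-assoc p (inv q) q ⟩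
  p * (inv q * q)  ≡⟨ cong (p *_) (inv-inverseˡ q≢0) ⟩
  p * 1ℚ           ≡⟨ *-identityʳ p ⟩
  p                ∎

*-/'-cancel : ∀ p {q} → q ≢ 0ℚ → (p * q) /' q ≡ p
*-/'-cancel p {q} q≢0 = begin
  p * q * inv q    ≡⟨ *-assoc p q (inv q) ⟩
  p * (q * inv q)  ≡⟨ cong (p *_) (inv-inverseʳ q≢0) ⟩
  p * 1ℚ           ≡⟨ *-identityʳ p ⟩
  p                ∎

*-cancelʳ-≢0 : ∀ {x y m} → m ≢ 0ℚ → x * m ≡ y * m → x ≡ y
*-cancelʳ-≢0 {x} {y} {m} m≢0 xm≡ym = begin
  x             ≡⟨ *-/'-cancel x m≢0 ⟨
  (x * m) /' m  ≡⟨ cong (_/' m) xm≡ym ⟩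
  (y * m) /' m  ≡⟨ *-/'-cancel y m≢0 ⟩
  y             ∎

*-≢0 : ∀ {x y} → x ≢ 0ℚ → y ≢ 0ℚ → x * y ≢ 0ℚ
*-≢0 {x} {y} x≢0 y≢0 xy≡0 = x≢0 (*-cancelʳ-≢0 y≢0 (trans xy≡0 (sym (*-zeroˡ y))))

/'-≢0 : ∀ {p q} → p ≢ 0ℚ → q ≢ 0ℚ → p /' q ≢ 0ℚ
/'-≢0 {p} {q} p≢0 q≢0 p/q≡0 = p≢0 (begin
  p             ≡⟨ /'-*-cancel p q≢0 ⟨
  (p /' q) * q  ≡⟨ cong (_* q) p/q≡0 ⟩
  0ℚ * q        ≡⟨ *-zeroˡ q ⟩
  0ℚ            ∎)

/'-*-scale : ∀ p {q} c → q ≢ 0ℚ → (p /' q) * (q * c) ≡ p * c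
/'-*-scale p {q} c q≢0 = trans (sym (*-assoc (p /' q) q c)) (cong (_* c) (/'-*-cancel p q≢0))

/'-*-unique : ∀ p {q r} a → q ≢ 0ℚ → p * a ≡ r * q → (p /' q) * a ≡ r
/'-*-unique p {q} {r} a q≢0 pa≡rq = *-cancelʳ-≢0 q≢0 (begin
  (p /' q) * a * q    ≡⟨ swap (p /' q) a q ⟩
  (p /' q) * q * a    ≡⟨ cong (_* a) (/'-*-cancel p q≢0) ⟩
  p * a               ≡⟨ pa≡rq ⟩
  r * q               ∎)
  where
  swap : ∀ x y z → x * y * z ≡ x * z * y
  swap = solve-∀ ℚ-ring

inv-unique : ∀ {q r} → q ≢ 0ℚ → r * q ≡ 1ℚ → inv q ≡ r
inv-unique {q} {r} q≢0 rq≡1 = begin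
  inv q                ≡⟨ *-identityˡ (inv q) ⟨
  1ℚ * inv q           ≡⟨ cong (_* inv q) rq≡1 ⟨
  r * q * inv q        ≡⟨ *-/'-cancel r q≢0 ⟩
  r                    ∎

inv-neg : ∀ q → inv (- q) ≡ - inv q
inv-neg q = by-cases (q ≟ 0ℚ)
  where
  by-cases : Dec (q ≡ 0ℚ) → inv (- q) ≡ - inv q
  by-cases (yes refl) = refl
  by-cases (no q≢0)   = inv-unique (λ -q≡0 → q≢0 (neg-injective -q≡0)) (begin
    - inv q * - q  ≡⟨ neg-*-neg (inv q) q ⟩
    inv q * q      ≡⟨ inv-inverseˡ q≢0 ⟩
    1ℚ             ∎)

∣p∣*∣p∣≡p*p : ∀ p → ∣ p ∣ * ∣ p ∣ ≡ p * p
∣p∣*∣p∣≡p*p p with ∣p∣≡p∨∣p∣≡-p p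
... | inj₁ ∣p∣≡p  = cong (λ x → x * x) ∣p∣≡p
... | inj₂ ∣p∣≡-p = trans (cong (λ x → x * x) ∣p∣≡-p) (neg-*-neg p p)

/'-∣∣-square : ∀ p q → (p /' ∣ q ∣) * (p /' ∣ q ∣) ≡ (p /' q) * (p /' q)
/'-∣∣-square p q with ∣p∣≡p∨∣p∣≡-p q
... | inj₁ ∣q∣≡q  = cong (λ d → (p /' d) * (p /' d)) ∣q∣≡q
... | inj₂ ∣q∣≡-q = begin
  (p /' ∣ q ∣) * (p /' ∣ q ∣)        ≡⟨ cong (λ d → (p /' d) * (p /' d)) ∣q∣≡-q ⟩
  (p * inv (- q)) * (p * inv (- q))  ≡⟨ cong (λ i → (p * i) * (p * i)) (inv-neg q) ⟩
  (p * - inv q) * (p * - inv q)      ≡⟨ square-neg p (inv q) ⟩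
  (p * inv q) * (p * inv q)          ∎
  where
  square-neg : ∀ x y → (x * - y) * (x * - y) ≡ (x * y) * (x * y)
  square-neg = solve-∀ ℚ-ring

pos⇒≢0 : ∀ {x} → 0ℚ < x → x ≢ 0ℚ
pos⇒≢0 0<x x≡0 = <⇒≢ 0<x (sym x≡0)

*-pos : ∀ {x y} → 0ℚ < x → 0ℚ < y → 0ℚ < x * y
*-pos {x} {y} 0<x 0<y = positive⁻¹ (x * y) {{pos*pos⇒pos x {{positive 0<x}} y {{positive 0<y}}}}

+-pos : ∀ {x y} → 0ℚ < x → 0ℚ < y → 0ℚ < x + y
+-pos {x} {y} 0<x 0<y = positive⁻¹ (x + y) {{pos+pos⇒pos x {{positive 0<x}} y {{positive 0<y}}}}

0<2 : 0ℚ < 2ℚ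
0<2 = positive⁻¹ 2ℚ

+-nonNeg-pos : ∀ {x y} → 0ℚ ≤ x → 0ℚ < y → 0ℚ < x + y
+-nonNeg-pos {x} {y} 0≤x 0<y = positive⁻¹ (x + y) {{nonNeg+pos⇒pos x {{nonNegative 0≤x}} y {{positive 0<y}}}}

*-cancelʳ-pos : ∀ {x y} → 0ℚ < y → 0ℚ < x * y → 0ℚ < x
*-cancelʳ-pos {x} {y} 0<y 0<xy =
  *-cancelʳ-<-nonNeg y {{nonNegative (<⇒≤ 0<y)}} (subst (_< x * y) (sym (*-zeroˡ y)) 0<xy)

∣∣-pos : ∀ {x} → x ≢ 0ℚ → 0ℚ < ∣ x ∣
∣∣-pos {x} x≢0 with <-cmp 0ℚ ∣ x ∣
... | tri< 0<∣x∣ _ _ = 0<∣x∣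
... | tri≈ _ 0≡∣x∣ _ = contradiction (∣p∣≡0⇒p≡0 x (sym 0≡∣x∣)) x≢0
... | tri> _ _ ∣x∣<0 = contradiction (≤-<-trans (0≤∣p∣ x) ∣x∣<0) (<-irrefl refl)

square-nonNeg : ∀ x → 0ℚ ≤ x * x
square-nonNeg x = subst (0ℚ ≤_) (∣p∣*∣p∣≡p*p x)
  (nonNegative⁻¹ _ {{nonNeg*nonNeg⇒nonNeg (∣ x ∣) {{∣-∣-nonNeg x}} (∣ x ∣) {{∣-∣-nonNeg x}}}})

∣∣-*-≡ : ∀ x {a b} → 0ℚ < a → 0ℚ < b → x * a ≡ b → ∣ x ∣ * a ≡ b
∣∣-*-≡ x {a} {b} 0<a 0<b xa≡b = begin
  ∣ x ∣ * a  ≡⟨ cong (_* a) (0≤p⇒∣p∣≡p (<⇒≤ 0<x)) ⟩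
  x * a      ≡⟨ xa≡b ⟩
  b          ∎
  where
  0<x : 0ℚ < x
  0<x = *-cancelʳ-pos 0<a (subst (0ℚ <_) (sym xa≡b) 0<b)

square-pos : ∀ {x} → x ≢ 0ℚ → 0ℚ < x * x
square-pos {x} x≢0 = subst (0ℚ <_) (∣p∣*∣p∣≡p*p x) (*-pos (∣∣-pos x≢0) (∣∣-pos x≢0))

pythagorean-of-ratios : ∀ {p q r} u v w d → d ≢ 0ℚ →
  u * d ≡ p → v * d ≡ q → w * d ≡ r → p * p + q * q ≡ r * r → u * u + v * v ≡ w * w
pythagorean-of-ratios {p} {q} {r} u v w d d≢0 ud≡p vd≡q wd≡r pythagoras =
  *-cancelʳ-≢0 (*-≢0 d≢0 d≢0) (begin
    (u * u + v * v) * (d * d)              ≡⟨ *-distribʳ-+ (d * d) (u * u) (v * v) ⟩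
    u * u * (d * d) + v * v * (d * d)      ≡⟨ cong₂ _+_ (square-* u d) (square-* v d) ⟨
    (u * d) * (u * d) + (v * d) * (v * d)  ≡⟨ cong₂ (λ x y → x * x + y * y) ud≡p vd≡q ⟩
    p * p + q * q                          ≡⟨ pythagoras ⟩
    r * r                                  ≡⟨ cong (λ x → x * x) wd≡r ⟨
    (w * d) * (w * d)                      ≡⟨ square-* w d ⟩
    (w * w) * (d * d)                      ∎)

IsNPC-scale : ∀ {b c dbc dac ds} a → 0ℚ < a → IsNPC 1ℚ b c dbc dac ds →
              IsNPC a (b * a) (c * a) (dbc * a) (dac * a) (ds * a)
IsNPC-scale {b} {c} {dbc} {dac} {ds} a 0<a (_ , 0<b , 0<c , 0<dbc , 0<dac , 0<ds , bc , ac , abc) =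
  0<a , *-pos 0<b 0<a , *-pos 0<c 0<a , *-pos 0<dbc 0<a , *-pos 0<dac 0<a , *-pos 0<ds 0<a ,
  rescale dbc (expand-bc b c a) bc , rescale dac (expand-ac c a) ac , rescale ds (expand-abc b c a) abc
  where
  rescale : ∀ {l x} y → l ≡ x * (a * a) → x ≡ y * y → l ≡ (y * a) * (y * a)
  rescale y l≡x·a² x≡y² = trans l≡x·a² (trans (cong (_* (a * a)) x≡y²) (sym (square-* y a)))
  expand-bc : ∀ b c a → (b * a) * (b * a) + (c * a) * (c * a) ≡ (b * b + c * c) * (a * a)
  expand-bc = solve-∀ ℚ-ring
  expand-ac : ∀ c a → a * a + (c * a) * (c * a) ≡ (1ℚ * 1ℚ + c * c) * (a * a)
  expand-ac = solve-∀ ℚ-ring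
  expand-abc : ∀ b c a → a * a + (b * a) * (b * a) + (c * a) * (c * a)
                         ≡ (1ℚ * 1ℚ + b * b + c * c) * (a * a)
  expand-abc = solve-∀ ℚ-ring

face-diagonal : ∀ k a → a * a + (∣ k ∣ * a) * (∣ k ∣ * a) ≡ (1ℚ + sq k) * (a * a)
face-diagonal k a = begin
  a * a + (∣ k ∣ * a) * (∣ k ∣ * a)  ≡⟨ expand ∣ k ∣ a ⟩
  (1ℚ + ∣ k ∣ * ∣ k ∣) * (a * a)      ≡⟨ cong (λ x → (1ℚ + x) * (a * a)) (∣p∣*∣p∣≡p*p k) ⟩
  (1ℚ + k * k) * (a * a)              ∎
  where
  expand : ∀ x a → a * a + (x * a) * (x * a) ≡ (1ℚ + x * x) * (a * a)
  expand = solve-∀ ℚ-ring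

OnCN-product : ∀ N X Y Z W → OnCN N X Y → OnCN N Z W →
               (Y * W) * (Y * W) ≡ (X * Z) * ((X * X - N * N) * (Z * Z - N * N))
OnCN-product N X Y Z W X∈C Z∈C = begin
  (Y * W) * (Y * W)                                  ≡⟨ square-* Y W ⟩
  (Y * Y) * (W * W)                                  ≡⟨ cong₂ _*_ X∈C Z∈C ⟩
  (X * X * X - N * N * X) * (Z * Z * Z - N * N * Z)  ≡⟨ solve (N ∷ X ∷ Z ∷ []) ℚ-ring ⟩
  (X * Z) * ((X * X - N * N) * (Z * Z - N * N))      ∎

OnCN-scaled : ∀ m n x y → m * (x * (x * x - n * n)) ≡ y * y → OnCN (m * n) (m * x) (m * y)
OnCN-scaled m n x y mx[x²-n²]≡y² = begin
  (m * y) * (m * y)                                    ≡⟨ square-* m y ⟩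
  (m * m) * (y * y)                                    ≡⟨ cong ((m * m) *_) mx[x²-n²]≡y² ⟨
  (m * m) * (m * (x * (x * x - n * n)))                ≡⟨ solve (m ∷ n ∷ x ∷ []) ℚ-ring ⟩
  m * x * (m * x) * (m * x) - m * n * (m * n) * (m * x)  ∎

module Forward {N X Y Z W s : ℚ} (0<N : 0ℚ < N) (X∈C : OnCN N X Y) (Z∈C : OnCN N Z W)
               (Y≢0 : Y ≢ 0ℚ) (W≢0 : W ≢ 0ℚ) (X≢Z : X ≢ Z) (s²≡XZ : s * s ≡ X * Z) (0<s : 0ℚ < s) where

  K C E F G F₀ : ℚ
  K  = kRatio N X Y Z W
  C  = (Y * W) /' (N * (X + Z) * s)
  E  = (Y * W) /' (N * (Z - X) * s)
  F  = (X * Z + N * N) /' ∣ N * (X + Z) ∣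
  G  = (X * Z - N * N) /' (N * (Z - X))
  F₀ = (X * Z + N * N) /' (N * (X + Z))

  0<XZ : 0ℚ < X * Z
  0<XZ = subst (0ℚ <_) s²≡XZ (*-pos 0<s 0<s)

  -- X (X + Z) = X² + s² > 0.
  X+Z≢0 : X + Z ≢ 0ℚ
  X+Z≢0 X+Z≡0 = <⇒≢ (+-nonNeg-pos (square-nonNeg X) 0<XZ) (sym (begin
    X * X + X * Z  ≡⟨ *-distribˡ-+ X X Z ⟨
    X * (X + Z)    ≡⟨ cong (X *_) X+Z≡0 ⟩
    X * 0ℚ         ≡⟨ *-zeroʳ X ⟩
    0ℚ             ∎))

  Z-X≢0 : Z - X ≢ 0ℚ
  Z-X≢0 Z-X≡0 = X≢Z (sym (x∙y⁻¹≈ε⇒x≈y Z X Z-X≡0))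

  N≢0 : N ≢ 0ℚ
  N≢0 = pos⇒≢0 0<N

  N[X+Z]≢0 : N * (X + Z) ≢ 0ℚ
  N[X+Z]≢0 = *-≢0 N≢0 X+Z≢0

  N[Z-X]≢0 : N * (Z - X) ≢ 0ℚ
  N[Z-X]≢0 = *-≢0 N≢0 Z-X≢0

  N[Z²-X²]≢0 : N * (Z * Z - X * X) ≢ 0ℚ
  N[Z²-X²]≢0 = *-≢0 N≢0 Z²-X²≢0
    where
    Z²-X²≢0 : Z * Z - X * X ≢ 0ℚ
    Z²-X²≢0 Z²-X²≡0 = *-≢0 Z-X≢0 X+Z≢0 (begin
      (Z - X) * (X + Z)  ≡⟨ cong ((Z - X) *_) (+-comm X Z) ⟩
      (Z - X) * (Z + X)  ≡⟨ x²-y²≡[x-y][x+y] Z X ⟨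
      Z * Z - X * X      ≡⟨ Z²-X²≡0 ⟩
      0ℚ                 ∎)

  YW≢0 : Y * W ≢ 0ℚ
  YW≢0 = *-≢0 Y≢0 W≢0

  [YW]² : (Y * W) * (Y * W) ≡ (X * Z) * ((X * X - N * N) * (Z * Z - N * N))
  [YW]² = OnCN-product N X Y Z W X∈C Z∈C

  K²+C²≡E² : K * K + C * C ≡ E * E
  K²+C²≡E² = pythagorean-of-ratios K C E d (*-≢0 N[Z²-X²]≢0 (pos⇒≢0 0<s))
    (/'-*-scale (2ℚ * Y * W) s N[Z²-X²]≢0)
    (trans (cong (C *_) d≡C-den) (/'-*-scale (Y * W) (Z - X) (*-≢0 N[X+Z]≢0 (pos⇒≢0 0<s))))
    (trans (cong (E *_) d≡E-den) (/'-*-scale (Y * W) (X + Z) (*-≢0 N[Z-X]≢0 (pos⇒≢0 0<s))))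
    (begin
      ((2ℚ * Y * W) * s) * ((2ℚ * Y * W) * s) + ((Y * W) * (Z - X)) * ((Y * W) * (Z - X))
        ≡⟨ solve (X ∷ Y ∷ Z ∷ W ∷ s ∷ []) ℚ-ring ⟩
      (Y * W) * (Y * W) * ((2ℚ * 2ℚ) * (s * s) + (Z - X) * (Z - X))
        ≡⟨ cong (λ σ → (Y * W) * (Y * W) * ((2ℚ * 2ℚ) * σ + (Z - X) * (Z - X))) s²≡XZ ⟩
      (Y * W) * (Y * W) * ((2ℚ * 2ℚ) * (X * Z) + (Z - X) * (Z - X))
        ≡⟨ solve (X ∷ Y ∷ Z ∷ W ∷ []) ℚ-ring ⟩
      ((Y * W) * (X + Z)) * ((Y * W) * (X + Z)) ∎)
    where
    d : ℚ
    d = N * (Z * Z - X * X) * s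
    d≡C-den : N * (Z * Z - X * X) * s ≡ N * (X + Z) * s * (Z - X)
    d≡C-den = solve (N ∷ X ∷ Z ∷ s ∷ []) ℚ-ring
    d≡E-den : N * (Z * Z - X * X) * s ≡ N * (Z - X) * s * (X + Z)
    d≡E-den = solve (N ∷ X ∷ Z ∷ s ∷ []) ℚ-ring

  1+C²≡F₀² : 1ℚ * 1ℚ + C * C ≡ F₀ * F₀
  1+C²≡F₀² = pythagorean-of-ratios 1ℚ C F₀ (N * (X + Z) * s) (*-≢0 N[X+Z]≢0 (pos⇒≢0 0<s))
    (*-identityˡ (N * (X + Z) * s))
    (/'-*-cancel (Y * W) (*-≢0 N[X+Z]≢0 (pos⇒≢0 0<s)))
    (/'-*-scale (X * Z + N * N) s N[X+Z]≢0)
    (begin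
      (N * (X + Z) * s) * (N * (X + Z) * s) + (Y * W) * (Y * W)
        ≡⟨ solve (N ∷ X ∷ Y ∷ Z ∷ W ∷ s ∷ []) ℚ-ring ⟩
      N * N * ((X + Z) * (X + Z)) * (s * s) + (Y * W) * (Y * W)
        ≡⟨ cong₂ (λ σ t → N * N * ((X + Z) * (X + Z)) * σ + t) s²≡XZ [YW]² ⟩
      N * N * ((X + Z) * (X + Z)) * (X * Z)
        + (X * Z) * ((X * X - N * N) * (Z * Z - N * N))
        ≡⟨ solve (N ∷ X ∷ Z ∷ []) ℚ-ring ⟩
      (X * Z + N * N) * (X * Z + N * N) * (X * Z)
        ≡⟨ cong ((X * Z + N * N) * (X * Z + N * N) *_) s²≡XZ ⟨
      (X * Z + N * N) * (X * Z + N * N) * (s * s)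
        ≡⟨ square-* (X * Z + N * N) s ⟨
      ((X * Z + N * N) * s) * ((X * Z + N * N) * s) ∎)

  F₀²+K²≡G² : F₀ * F₀ + K * K ≡ G * G
  F₀²+K²≡G² = pythagorean-of-ratios F₀ K G (N * (Z * Z - X * X)) N[Z²-X²]≢0
    (trans (cong (F₀ *_) d≡F₀-den) (/'-*-scale (X * Z + N * N) (Z - X) N[X+Z]≢0))
    (/'-*-cancel (2ℚ * Y * W) N[Z²-X²]≢0)
    (trans (cong (G *_) d≡G-den) (/'-*-scale (X * Z - N * N) (X + Z) N[Z-X]≢0))
    (begin
      ((X * Z + N * N) * (Z - X)) * ((X * Z + N * N) * (Z - X)) + (2ℚ * Y * W) * (2ℚ * Y * W)
        ≡⟨ solve (N ∷ X ∷ Y ∷ Z ∷ W ∷ []) ℚ-ring ⟩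
      ((X * Z + N * N) * (Z - X)) * ((X * Z + N * N) * (Z - X)) + (2ℚ * 2ℚ) * ((Y * W) * (Y * W))
        ≡⟨ cong (λ t → ((X * Z + N * N) * (Z - X)) * ((X * Z + N * N) * (Z - X)) + (2ℚ * 2ℚ) * t) [YW]² ⟩
      ((X * Z + N * N) * (Z - X)) * ((X * Z + N * N) * (Z - X))
        + (2ℚ * 2ℚ) * ((X * Z) * ((X * X - N * N) * (Z * Z - N * N)))
        ≡⟨ solve (N ∷ X ∷ Z ∷ []) ℚ-ring ⟩
      ((X * Z - N * N) * (X + Z)) * ((X * Z - N * N) * (X + Z)) ∎)
    where
    d≡F₀-den : N * (Z * Z - X * X) ≡ N * (X + Z) * (Z - X)
    d≡F₀-den = solve (N ∷ X ∷ Z ∷ []) ℚ-ring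
    d≡G-den : N * (Z * Z - X * X) ≡ N * (Z - X) * (X + Z)
    d≡G-den = solve (N ∷ X ∷ Z ∷ []) ℚ-ring

  K≢0 : K ≢ 0ℚ
  K≢0 = /'-≢0 (*-≢0 (*-≢0 (pos⇒≢0 0<2) Y≢0) W≢0) N[Z²-X²]≢0

  C≢0 : C ≢ 0ℚ
  C≢0 = /'-≢0 YW≢0 (*-≢0 N[X+Z]≢0 (pos⇒≢0 0<s))

  E≢0 : E ≢ 0ℚ
  E≢0 = /'-≢0 YW≢0 (*-≢0 N[Z-X]≢0 (pos⇒≢0 0<s))

  0<F : 0ℚ < F
  0<F = *-cancelʳ-pos 0<∣N[X+Z]∣
          (subst (0ℚ <_) (sym (/'-*-cancel (X * Z + N * N) (pos⇒≢0 0<∣N[X+Z]∣))) (+-pos 0<XZ (*-pos 0<N 0<N)))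
    where
    0<∣N[X+Z]∣ : 0ℚ < ∣ N * (X + Z) ∣
    0<∣N[X+Z]∣ = ∣∣-pos N[X+Z]≢0

  G≢0 : G ≢ 0ℚ
  G≢0 G≡0 = <⇒≢ (+-nonNeg-pos (square-nonNeg F₀) (square-pos K≢0)) (sym (begin
    F₀ * F₀ + K * K  ≡⟨ F₀²+K²≡G² ⟩
    G * G            ≡⟨ cong (λ g → g * g) G≡0 ⟩
    0ℚ * 0ℚ          ≡⟨⟩
    0ℚ               ∎))

  unit-NPC : IsNPC 1ℚ (∣ K ∣) (∣ C ∣) (∣ E ∣) F (∣ G ∣)
  unit-NPC = positive⁻¹ 1ℚ , ∣∣-pos K≢0 , ∣∣-pos C≢0 , ∣∣-pos E≢0 , 0<F , ∣∣-pos G≢0 ,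
             b²+c²≡dbc² , 1+c²≡dac² , 1+b²+c²≡ds²
    where
    b²+c²≡dbc² : ∣ K ∣ * ∣ K ∣ + ∣ C ∣ * ∣ C ∣ ≡ ∣ E ∣ * ∣ E ∣
    b²+c²≡dbc² = begin
      ∣ K ∣ * ∣ K ∣ + ∣ C ∣ * ∣ C ∣  ≡⟨ cong₂ _+_ (∣p∣*∣p∣≡p*p K) (∣p∣*∣p∣≡p*p C) ⟩
      K * K + C * C                  ≡⟨ K²+C²≡E² ⟩
      E * E                          ≡⟨ ∣p∣*∣p∣≡p*p E ⟨
      ∣ E ∣ * ∣ E ∣                  ∎

    1+c²≡dac² : 1ℚ * 1ℚ + ∣ C ∣ * ∣ C ∣ ≡ F * F
    1+c²≡dac² = begin
      1ℚ * 1ℚ + ∣ C ∣ * ∣ C ∣  ≡⟨ cong (1ℚ * 1ℚ +_) (∣p∣*∣p∣≡p*p C) ⟩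
      1ℚ * 1ℚ + C * C          ≡⟨ 1+C²≡F₀² ⟩
      F₀ * F₀                  ≡⟨ /'-∣∣-square (X * Z + N * N) (N * (X + Z)) ⟨
      F * F                    ∎

    1+b²+c²≡ds² : 1ℚ * 1ℚ + ∣ K ∣ * ∣ K ∣ + ∣ C ∣ * ∣ C ∣ ≡ ∣ G ∣ * ∣ G ∣
    1+b²+c²≡ds² = begin
      1ℚ * 1ℚ + ∣ K ∣ * ∣ K ∣ + ∣ C ∣ * ∣ C ∣
        ≡⟨ cong₂ (λ k c → 1ℚ * 1ℚ + k + c) (∣p∣*∣p∣≡p*p K) (∣p∣*∣p∣≡p*p C) ⟩
      1ℚ * 1ℚ + K * K + C * C                  ≡⟨ swap (1ℚ * 1ℚ) (K * K) (C * C) ⟩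
      1ℚ * 1ℚ + C * C + K * K                  ≡⟨ cong (_+ K * K) 1+C²≡F₀² ⟩
      F₀ * F₀ + K * K                          ≡⟨ F₀²+K²≡G² ⟩
      G * G                                    ≡⟨ ∣p∣*∣p∣≡p*p G ⟨
      ∣ G ∣ * ∣ G ∣                            ∎
      where
      swap : ∀ x y z → x + y + z ≡ x + z + y
      swap = solve-∀ ℚ-ring

npc-from-curve : ∀ N X Y Z W s → Admissible N X Y Z W s → ∀ a → 0ℚ < a →
  IsNPC a (b′ N X Y Z W s a) (c′ N X Y Z W s a) (dbc′ N X Y Z W s a) (dac′ N X Y Z W s a) (ds′ N X Y Z W s a)
  × (a * a + b′ N X Y Z W s a * b′ N X Y Z W s a ≡ (1ℚ + sq (kRatio N X Y Z W)) * (a * a))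
npc-from-curve N X Y Z W s (0<N , X∈C , Z∈C , Y≢0 , W≢0 , X≢Z , s²≡XZ , 0<s) a 0<a =
  IsNPC-scale a 0<a (Forward.unit-NPC 0<N X∈C Z∈C Y≢0 W≢0 X≢Z s²≡XZ 0<s) ,
  face-diagonal (kRatio N X Y Z W) a

-- D, P, Q, M are parameters with defining equations rather than definitions, so that the ring
-- solver can treat them as variables.
module Converse {a b c dbc dac ds D P Q M : ℚ}
  (0<a : 0ℚ < a) (0<b : 0ℚ < b) (0<c : 0ℚ < c) (0<dbc : 0ℚ < dbc) (0<dac : 0ℚ < dac) (0<ds : 0ℚ < ds)
  (bc : b * b + c * c ≡ dbc * dbc) (ac : a * a + c * c ≡ dac * dac) (abc : a * a + b * b + c * c ≡ ds * ds)
  (D-def : D ≡ dac * dbc - ds * c) (P-def : P ≡ a * (dbc + c)) (Q-def : Q ≡ a * (dbc - c))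
  (M-def : M ≡ P * (P * P - D * D)) where

  diagonals : (a * b) * (a * b) + (ds * c) * (ds * c) ≡ (dac * dbc) * (dac * dbc)
  diagonals = begin
    (a * b) * (a * b) + (ds * c) * (ds * c)      ≡⟨ solve (a ∷ b ∷ c ∷ ds ∷ []) ℚ-ring ⟩
    (a * a) * (b * b) + (ds * ds) * (c * c)      ≡⟨ cong (λ t → (a * a) * (b * b) + t * (c * c)) abc ⟨
    (a * a) * (b * b) + (a * a + b * b + c * c) * (c * c)  ≡⟨ solve (a ∷ b ∷ c ∷ []) ℚ-ring ⟩
    (a * a + c * c) * (b * b + c * c)            ≡⟨ cong₂ _*_ ac bc ⟩
    (dac * dac) * (dbc * dbc)                    ≡⟨ square-* dac dbc ⟨
    (dac * dbc) * (dac * dbc)                    ∎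

  dac²-a² : dac * dac - a * a ≡ c * c
  dac²-a² = begin
    dac * dac - a * a          ≡⟨ cong (_- a * a) ac ⟨
    a * a + c * c - a * a      ≡⟨ solve (a ∷ c ∷ []) ℚ-ring ⟩
    c * c                      ∎

  P+Q : P + Q ≡ 2ℚ * a * dbc
  P+Q = begin
    P + Q                        ≡⟨ cong₂ _+_ P-def Q-def ⟩
    a * (dbc + c) + a * (dbc - c)  ≡⟨ solve (a ∷ c ∷ dbc ∷ []) ℚ-ring ⟩
    2ℚ * a * dbc                 ∎

  P-Q : P - Q ≡ 2ℚ * a * c
  P-Q = begin
    P - Q                        ≡⟨ cong₂ _-_ P-def Q-def ⟩
    a * (dbc + c) - a * (dbc - c)  ≡⟨ solve (a ∷ c ∷ dbc ∷ []) ℚ-ring ⟩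
    2ℚ * a * c                   ∎

  PQ : P * Q ≡ (a * b) * (a * b)
  PQ = begin
    P * Q                                      ≡⟨ cong₂ _*_ P-def Q-def ⟩
    a * (dbc + c) * (a * (dbc - c))            ≡⟨ solve (a ∷ c ∷ dbc ∷ []) ℚ-ring ⟩
    (a * a) * (dbc * dbc) - (a * a) * (c * c)  ≡⟨ cong (λ t → (a * a) * t - (a * a) * (c * c)) bc ⟨
    (a * a) * (b * b + c * c) - (a * a) * (c * c)  ≡⟨ solve (a ∷ b ∷ c ∷ []) ℚ-ring ⟩
    (a * b) * (a * b)                          ∎

  ab²+D² : (a * b) * (a * b) + D * D ≡ 2ℚ * dac * dbc * D
  ab²+D² = begin
    (a * b) * (a * b) + D * D
      ≡⟨ cong (λ d → (a * b) * (a * b) + d * d) D-def ⟩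
    (a * b) * (a * b) + (dac * dbc - ds * c) * (dac * dbc - ds * c)
      ≡⟨ solve (a ∷ b ∷ c ∷ dbc ∷ dac ∷ ds ∷ []) ℚ-ring ⟩
    ((a * b) * (a * b) + (ds * c) * (ds * c)) + (dac * dbc) * (dac * dbc) - 2ℚ * dac * dbc * (ds * c)
      ≡⟨ cong (λ t → t + (dac * dbc) * (dac * dbc) - 2ℚ * dac * dbc * (ds * c)) diagonals ⟩
    (dac * dbc) * (dac * dbc) + (dac * dbc) * (dac * dbc) - 2ℚ * dac * dbc * (ds * c)
      ≡⟨ solve (c ∷ dbc ∷ dac ∷ ds ∷ []) ℚ-ring ⟩
    2ℚ * dac * dbc * (dac * dbc - ds * c)
      ≡⟨ cong (2ℚ * dac * dbc *_) D-def ⟨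
    2ℚ * dac * dbc * D ∎

  ab²-D² : (a * b) * (a * b) - D * D ≡ 2ℚ * ds * c * D
  ab²-D² = begin
    (a * b) * (a * b) - D * D
      ≡⟨ cong (λ d → (a * b) * (a * b) - d * d) D-def ⟩
    (a * b) * (a * b) - (dac * dbc - ds * c) * (dac * dbc - ds * c)
      ≡⟨ solve (a ∷ b ∷ c ∷ dbc ∷ dac ∷ ds ∷ []) ℚ-ring ⟩
    (a * b) * (a * b) - (dac * dbc) * (dac * dbc) - (ds * c) * (ds * c) + 2ℚ * dac * dbc * (ds * c)
      ≡⟨ cong (λ t → (a * b) * (a * b) - t - (ds * c) * (ds * c) + 2ℚ * dac * dbc * (ds * c)) diagonals ⟨
    (a * b) * (a * b) - ((a * b) * (a * b) + (ds * c) * (ds * c))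
      - (ds * c) * (ds * c) + 2ℚ * dac * dbc * (ds * c)
      ≡⟨ solve (a ∷ b ∷ c ∷ dbc ∷ dac ∷ ds ∷ []) ℚ-ring ⟩
    2ℚ * ds * c * (dac * dbc - ds * c)
      ≡⟨ cong (2ℚ * ds * c *_) D-def ⟨
    2ℚ * ds * c * D ∎

  0<dac-a : 0ℚ < dac - a
  0<dac-a = *-cancelʳ-pos (+-pos 0<dac 0<a) (subst (0ℚ <_) (sym (begin
    (dac - a) * (dac + a)  ≡⟨ x²-y²≡[x-y][x+y] dac a ⟨
    dac * dac - a * a      ≡⟨ dac²-a² ⟩
    c * c                  ∎)) (*-pos 0<c 0<c))

  0<ab : 0ℚ < a * b
  0<ab = *-pos 0<a 0<b

  0<S : 0ℚ < dac * dbc + ds * c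
  0<S = +-pos (*-pos 0<dac 0<dbc) (*-pos 0<ds 0<c)

  D·S : D * (dac * dbc + ds * c) ≡ (a * b) * (a * b)
  D·S = begin
    D * (dac * dbc + ds * c)                               ≡⟨ cong (_* (dac * dbc + ds * c)) D-def ⟩
    (dac * dbc - ds * c) * (dac * dbc + ds * c)            ≡⟨ x²-y²≡[x-y][x+y] (dac * dbc) (ds * c) ⟨
    (dac * dbc) * (dac * dbc) - (ds * c) * (ds * c)        ≡⟨ cong (_- (ds * c) * (ds * c)) diagonals ⟨
    (a * b) * (a * b) + (ds * c) * (ds * c) - (ds * c) * (ds * c)  ≡⟨ solve (a ∷ b ∷ c ∷ ds ∷ []) ℚ-ring ⟩
    (a * b) * (a * b)                                      ∎

  0<D : 0ℚ < D
  0<D = *-cancelʳ-pos 0<S (subst (0ℚ <_) (sym D·S) (*-pos 0<ab 0<ab))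

  [P-D]·S : (P - D) * (dac * dbc + ds * c) ≡ a * (dbc + c) * ((dac - a) * dbc + (ds + a) * c)
  [P-D]·S = begin
    (P - D) * (dac * dbc + ds * c)
      ≡⟨ solve (P ∷ D ∷ c ∷ dbc ∷ dac ∷ ds ∷ []) ℚ-ring ⟩
    P * (dac * dbc + ds * c) - D * (dac * dbc + ds * c)
      ≡⟨ cong₂ (λ p t → p * (dac * dbc + ds * c) - t) P-def D·S ⟩
    a * (dbc + c) * (dac * dbc + ds * c) - (a * b) * (a * b)
      ≡⟨ solve (a ∷ b ∷ c ∷ dbc ∷ dac ∷ ds ∷ []) ℚ-ring ⟩
    a * (dbc + c) * (dac * dbc + ds * c) - ((a * a) * (b * b + c * c) - (a * a) * (c * c))
      ≡⟨ cong (λ t → a * (dbc + c) * (dac * dbc + ds * c) - ((a * a) * t - (a * a) * (c * c))) bc ⟩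
    a * (dbc + c) * (dac * dbc + ds * c) - ((a * a) * (dbc * dbc) - (a * a) * (c * c))
      ≡⟨ solve (a ∷ c ∷ dbc ∷ dac ∷ ds ∷ []) ℚ-ring ⟩
    a * (dbc + c) * ((dac - a) * dbc + (ds + a) * c) ∎

  0<P : 0ℚ < P
  0<P = subst (0ℚ <_) (sym P-def) (*-pos 0<a (+-pos 0<dbc 0<c))

  0<P-D : 0ℚ < P - D
  0<P-D = *-cancelʳ-pos 0<S (subst (0ℚ <_) (sym [P-D]·S)
    (*-pos (*-pos 0<a (+-pos 0<dbc 0<c)) (+-pos (*-pos 0<dac-a 0<dbc) (*-pos (+-pos 0<ds 0<a) 0<c))))

  0<M : 0ℚ < M
  0<M = subst (0ℚ <_) (sym (trans M-def (cong (P *_) (x²-y²≡[x-y][x+y] P D))))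
    (*-pos 0<P (*-pos 0<P-D (+-pos 0<P 0<D)))

  -- The data N = p (p² − 1), X = Nq, Z = Np, W = N² of the header, with N, X, Z, s scaled by D⁴
  -- and Y, W by D⁶.
  N′ X′ Y′ Z′ W′ s′ : ℚ
  N′ = M * D
  X′ = M * Q
  Y′ = M * (2ℚ * a * b * c * dbc * D)
  Z′ = M * P
  W′ = M * M
  s′ = M * (a * b)

  Z′-X′ : Z′ - X′ ≡ M * (2ℚ * a * c)
  Z′-X′ = begin
    M * P - M * Q    ≡⟨ solve (M ∷ P ∷ Q ∷ []) ℚ-ring ⟩
    M * (P - Q)      ≡⟨ cong (M *_) P-Q ⟩
    M * (2ℚ * a * c) ∎

  X′+Z′ : X′ + Z′ ≡ M * (2ℚ * a * dbc)
  X′+Z′ = begin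
    M * Q + M * P      ≡⟨ solve (M ∷ P ∷ Q ∷ []) ℚ-ring ⟩
    M * (P + Q)        ≡⟨ cong (M *_) P+Q ⟩
    M * (2ℚ * a * dbc) ∎

  0<Z′-X′ : 0ℚ < Z′ - X′
  0<Z′-X′ = subst (0ℚ <_) (sym Z′-X′) (*-pos 0<M (*-pos (*-pos 0<2 0<a) 0<c))

  0<X′+Z′ : 0ℚ < X′ + Z′
  0<X′+Z′ = subst (0ℚ <_) (sym X′+Z′) (*-pos 0<M (*-pos (*-pos 0<2 0<a) 0<dbc))

  0<N′ : 0ℚ < N′
  0<N′ = *-pos 0<M 0<D

  0<s′ : 0ℚ < s′
  0<s′ = *-pos 0<M 0<ab

  [P²-D²][Q²-D²] : (P * P - D * D) * (Q * Q - D * D) ≡ (2ℚ * c * dbc * D) * (2ℚ * c * dbc * D)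
  [P²-D²][Q²-D²] = begin
    (P * P - D * D) * (Q * Q - D * D)
      ≡⟨ solve (P ∷ Q ∷ D ∷ []) ℚ-ring ⟩
    (P * Q + D * D) * (P * Q + D * D) - (D * (P + Q)) * (D * (P + Q))
      ≡⟨ cong₂ (λ u v → (u + D * D) * (u + D * D) - (D * v) * (D * v)) PQ P+Q ⟩
    ((a * b) * (a * b) + D * D) * ((a * b) * (a * b) + D * D) - (D * (2ℚ * a * dbc)) * (D * (2ℚ * a * dbc))
      ≡⟨ cong (λ u → u * u - (D * (2ℚ * a * dbc)) * (D * (2ℚ * a * dbc))) ab²+D² ⟩
    (2ℚ * dac * dbc * D) * (2ℚ * dac * dbc * D) - (D * (2ℚ * a * dbc)) * (D * (2ℚ * a * dbc))
      ≡⟨ solve (a ∷ dbc ∷ dac ∷ D ∷ []) ℚ-ring ⟩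
    (2ℚ * dbc * D) * (2ℚ * dbc * D) * (dac * dac - a * a)
      ≡⟨ cong ((2ℚ * dbc * D) * (2ℚ * dbc * D) *_) dac²-a² ⟩
    (2ℚ * dbc * D) * (2ℚ * dbc * D) * (c * c)
      ≡⟨ solve (c ∷ dbc ∷ D ∷ []) ℚ-ring ⟩
    (2ℚ * c * dbc * D) * (2ℚ * c * dbc * D) ∎

  X′∈C : OnCN N′ X′ Y′
  X′∈C = OnCN-scaled M D Q (2ℚ * a * b * c * dbc * D) (begin
    M * (Q * (Q * Q - D * D))
      ≡⟨ cong (λ m → m * (Q * (Q * Q - D * D))) M-def ⟩
    P * (P * P - D * D) * (Q * (Q * Q - D * D))
      ≡⟨ solve (P ∷ Q ∷ D ∷ []) ℚ-ring ⟩
    (P * Q) * ((P * P - D * D) * (Q * Q - D * D))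
      ≡⟨ cong₂ _*_ PQ [P²-D²][Q²-D²] ⟩
    (a * b) * (a * b) * ((2ℚ * c * dbc * D) * (2ℚ * c * dbc * D))
      ≡⟨ solve (a ∷ b ∷ c ∷ dbc ∷ D ∷ []) ℚ-ring ⟩
    (2ℚ * a * b * c * dbc * D) * (2ℚ * a * b * c * dbc * D) ∎)

  Z′∈C : OnCN N′ Z′ W′
  Z′∈C = OnCN-scaled M D P M (cong (M *_) (sym M-def))

  s′²≡X′Z′ : s′ * s′ ≡ X′ * Z′
  s′²≡X′Z′ = begin
    (M * (a * b)) * (M * (a * b))  ≡⟨ square-* M (a * b) ⟩
    (M * M) * ((a * b) * (a * b))  ≡⟨ cong ((M * M) *_) PQ ⟨
    (M * M) * (P * Q)              ≡⟨ solve (M ∷ P ∷ Q ∷ []) ℚ-ring ⟩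
    (M * Q) * (M * P)              ∎

  admissible : Admissible N′ X′ Y′ Z′ W′ s′
  admissible = 0<N′ , X′∈C , Z′∈C , pos⇒≢0 0<Y′ , pos⇒≢0 (*-pos 0<M 0<M) , X′≢Z′ , s′²≡X′Z′ , 0<s′
    where
    0<Y′ : 0ℚ < Y′
    0<Y′ = *-pos 0<M (*-pos (*-pos (*-pos (*-pos (*-pos 0<2 0<a) 0<b) 0<c) 0<dbc) 0<D)
    X′≢Z′ : X′ ≢ Z′
    X′≢Z′ X′≡Z′ = <⇒≢ 0<Z′-X′ (sym (trans (cong (λ x → Z′ - x) X′≡Z′) (+-inverseʳ Z′)))

  b-ratio·a : (2ℚ * Y′ * W′) * a ≡ b * (N′ * (Z′ * Z′ - X′ * X′))
  b-ratio·a = begin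
    (2ℚ * (M * (2ℚ * a * b * c * dbc * D)) * (M * M)) * a
      ≡⟨ solve (a ∷ b ∷ c ∷ dbc ∷ D ∷ M ∷ []) ℚ-ring ⟩
    b * (M * M * M * D) * ((2ℚ * a * c) * (2ℚ * a * dbc))
      ≡⟨ cong₂ (λ u v → b * (M * M * M * D) * (u * v)) P-Q P+Q ⟨
    b * (M * M * M * D) * ((P - Q) * (P + Q))
      ≡⟨ solve (b ∷ D ∷ M ∷ P ∷ Q ∷ []) ℚ-ring ⟩
    b * ((M * D) * ((M * P) * (M * P) - (M * Q) * (M * Q))) ∎

  c-ratio·a : (Y′ * W′) * a ≡ c * (N′ * (X′ + Z′) * s′)
  c-ratio·a = begin
    (M * (2ℚ * a * b * c * dbc * D) * (M * M)) * a
      ≡⟨ solve (a ∷ b ∷ c ∷ dbc ∷ D ∷ M ∷ []) ℚ-ring ⟩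
    c * (M * M * M * D) * ((2ℚ * a * dbc) * (a * b))
      ≡⟨ cong (λ u → c * (M * M * M * D) * (u * (a * b))) P+Q ⟨
    c * (M * M * M * D) * ((P + Q) * (a * b))
      ≡⟨ solve (a ∷ b ∷ c ∷ D ∷ M ∷ P ∷ Q ∷ []) ℚ-ring ⟩
    c * ((M * D) * (M * Q + M * P) * (M * (a * b))) ∎

  dbc-ratio·a : (Y′ * W′) * a ≡ dbc * (N′ * (Z′ - X′) * s′)
  dbc-ratio·a = begin
    (M * (2ℚ * a * b * c * dbc * D) * (M * M)) * a
      ≡⟨ solve (a ∷ b ∷ c ∷ dbc ∷ D ∷ M ∷ []) ℚ-ring ⟩
    dbc * (M * M * M * D) * ((2ℚ * a * c) * (a * b))
      ≡⟨ cong (λ u → dbc * (M * M * M * D) * (u * (a * b))) P-Q ⟨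
    dbc * (M * M * M * D) * ((P - Q) * (a * b))
      ≡⟨ solve (a ∷ b ∷ dbc ∷ D ∷ M ∷ P ∷ Q ∷ []) ℚ-ring ⟩
    dbc * ((M * D) * (M * P - M * Q) * (M * (a * b))) ∎

  dac-ratio·a : (X′ * Z′ + N′ * N′) * a ≡ dac * (N′ * (X′ + Z′))
  dac-ratio·a = begin
    ((M * Q) * (M * P) + (M * D) * (M * D)) * a
      ≡⟨ solve (a ∷ D ∷ M ∷ P ∷ Q ∷ []) ℚ-ring ⟩
    (M * M) * (P * Q + D * D) * a
      ≡⟨ cong (λ u → (M * M) * (u + D * D) * a) PQ ⟩
    (M * M) * ((a * b) * (a * b) + D * D) * a
      ≡⟨ cong (λ u → (M * M) * u * a) ab²+D² ⟩
    (M * M) * (2ℚ * dac * dbc * D) * a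
      ≡⟨ solve (a ∷ dbc ∷ dac ∷ D ∷ M ∷ []) ℚ-ring ⟩
    dac * (M * M * D) * (2ℚ * a * dbc)
      ≡⟨ cong (dac * (M * M * D) *_) P+Q ⟨
    dac * (M * M * D) * (P + Q)
      ≡⟨ solve (dac ∷ D ∷ M ∷ P ∷ Q ∷ []) ℚ-ring ⟩
    dac * ((M * D) * (M * Q + M * P)) ∎

  ds-ratio·a : (X′ * Z′ - N′ * N′) * a ≡ ds * (N′ * (Z′ - X′))
  ds-ratio·a = begin
    ((M * Q) * (M * P) - (M * D) * (M * D)) * a
      ≡⟨ solve (a ∷ D ∷ M ∷ P ∷ Q ∷ []) ℚ-ring ⟩
    (M * M) * (P * Q - D * D) * a
      ≡⟨ cong (λ u → (M * M) * (u - D * D) * a) PQ ⟩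
    (M * M) * ((a * b) * (a * b) - D * D) * a
      ≡⟨ cong (λ u → (M * M) * u * a) ab²-D² ⟩
    (M * M) * (2ℚ * ds * c * D) * a
      ≡⟨ solve (a ∷ c ∷ ds ∷ D ∷ M ∷ []) ℚ-ring ⟩
    ds * (M * M * D) * (2ℚ * a * c)
      ≡⟨ cong (ds * (M * M * D) *_) P-Q ⟨
    ds * (M * M * D) * (P - Q)
      ≡⟨ solve (ds ∷ D ∷ M ∷ P ∷ Q ∷ []) ℚ-ring ⟩
    ds * ((M * D) * (M * P - M * Q)) ∎

  recovers : ∀ p {q} r → 0ℚ < r → 0ℚ < q → p * a ≡ r * q → r ≡ ∣ p /' q ∣ * a
  recovers p {q} r 0<r 0<q pa≡rq = sym (∣∣-*-≡ (p /' q) 0<a 0<r (/'-*-unique p a (pos⇒≢0 0<q) pa≡rq))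

  0<N′[X′+Z′] : 0ℚ < N′ * (X′ + Z′)
  0<N′[X′+Z′] = *-pos 0<N′ 0<X′+Z′

  0<N′[Z′²-X′²] : 0ℚ < N′ * (Z′ * Z′ - X′ * X′)
  0<N′[Z′²-X′²] = *-pos 0<N′ (subst (0ℚ <_) (sym (x²-y²≡[x-y][x+y] Z′ X′))
                                     (*-pos 0<Z′-X′ (subst (0ℚ <_) (+-comm X′ Z′) 0<X′+Z′)))

  b≡b′ : b ≡ b′ N′ X′ Y′ Z′ W′ s′ a
  b≡b′ = recovers (2ℚ * Y′ * W′) b 0<b 0<N′[Z′²-X′²] b-ratio·a

  c≡c′ : c ≡ c′ N′ X′ Y′ Z′ W′ s′ a
  c≡c′ = recovers (Y′ * W′) c 0<c (*-pos 0<N′[X′+Z′] 0<s′) c-ratio·a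

  dbc≡dbc′ : dbc ≡ dbc′ N′ X′ Y′ Z′ W′ s′ a
  dbc≡dbc′ = recovers (Y′ * W′) dbc 0<dbc (*-pos (*-pos 0<N′ 0<Z′-X′) 0<s′) dbc-ratio·a

  dac≡dac′ : dac ≡ dac′ N′ X′ Y′ Z′ W′ s′ a
  dac≡dac′ = begin
    dac
      ≡⟨ /'-*-unique (X′ * Z′ + N′ * N′) a (pos⇒≢0 0<N′[X′+Z′]) dac-ratio·a ⟨
    ((X′ * Z′ + N′ * N′) /' (N′ * (X′ + Z′))) * a
      ≡⟨ cong (λ q → ((X′ * Z′ + N′ * N′) /' q) * a) (0≤p⇒∣p∣≡p (<⇒≤ 0<N′[X′+Z′])) ⟨
    ((X′ * Z′ + N′ * N′) /' ∣ N′ * (X′ + Z′) ∣) * a ∎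

  ds≡ds′ : ds ≡ ds′ N′ X′ Y′ Z′ W′ s′ a
  ds≡ds′ = recovers (X′ * Z′ - N′ * N′) ds 0<ds (*-pos 0<N′ 0<Z′-X′) ds-ratio·a

npc-to-curve : ∀ a b c dbc dac ds → IsNPC a b c dbc dac ds →
  ∃ λ N → ∃ λ X → ∃ λ Y → ∃ λ Z → ∃ λ W → ∃ λ s → ∃ λ a′ →
    Admissible N X Y Z W s × (0ℚ < a′) ×
    (a ≡ a′) × (b ≡ b′ N X Y Z W s a′) × (c ≡ c′ N X Y Z W s a′) ×
    (dbc ≡ dbc′ N X Y Z W s a′) × (dac ≡ dac′ N X Y Z W s a′) × (ds ≡ ds′ N X Y Z W s a′)
npc-to-curve a b c dbc dac ds (0<a , 0<b , 0<c , 0<dbc , 0<dac , 0<ds , bc , ac , abc) =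
  N′ , X′ , Y′ , Z′ , W′ , s′ , a , admissible , 0<a , refl , b≡b′ , c≡c′ , dbc≡dbc′ , dac≡dac′ , ds≡ds′
  where open Converse 0<a 0<b 0<c 0<dbc 0<dac 0<ds bc ac abc refl refl refl refl

square-root-pos : ∀ {r x} → r * r ≡ x → 0ℚ < x → 0ℚ < ∣ r ∣ × x ≡ ∣ r ∣ * ∣ r ∣
square-root-pos {r} r²≡x 0<x =
  ∣∣-pos (λ r≡0 → <⇒≢ 0<x (trans (sym (cong (λ t → t * t) r≡0)) r²≡x)) ,
  trans (sym r²≡x) (sym (∣p∣*∣p∣≡p*p r))

∃PerfectCuboid ∃RationalFaceDiagonal : Set
∃PerfectCuboid = ∃ λ a → ∃ λ b → ∃ λ c → PerfectCuboid a b c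
∃RationalFaceDiagonal = ∃ λ N → ∃ λ X → ∃ λ Y → ∃ λ Z → ∃ λ W → ∃ λ s → ∃ λ a′ →
  Admissible N X Y Z W s × (0ℚ < a′) × IsRationalSquare ((1ℚ + sq (kRatio N X Y Z W)) * (a′ * a′))

∃PerfectCuboid⇔∃RationalFaceDiagonal : ∃PerfectCuboid ⇔ ∃RationalFaceDiagonal
∃PerfectCuboid⇔∃RationalFaceDiagonal = mk⇔ to from
  where
  to : ∃PerfectCuboid → ∃RationalFaceDiagonal
  to (a , b , c , 0<a , 0<b , 0<c , (r₁ , r₁²) , (r₂ , r₂²) , (r₃ , r₃²) , (r₄ , r₄²)) =
    let 0<∣r₂∣ , bc  = square-root-pos r₂² (+-pos (*-pos 0<b 0<b) (*-pos 0<c 0<c))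
        0<∣r₃∣ , ac  = square-root-pos r₃² (+-pos (*-pos 0<a 0<a) (*-pos 0<c 0<c))
        0<∣r₄∣ , abc = square-root-pos r₄² (+-pos (+-pos (*-pos 0<a 0<a) (*-pos 0<b 0<b)) (*-pos 0<c 0<c))
        N , X , Y , Z , W , s , a′ , adm , 0<a′ , a≡a′ , b≡b′ , _ =
          npc-to-curve a b c (∣ r₂ ∣) (∣ r₃ ∣) (∣ r₄ ∣)
                       (0<a , 0<b , 0<c , 0<∣r₂∣ , 0<∣r₃∣ , 0<∣r₄∣ , bc , ac , abc)
    in N , X , Y , Z , W , s , a′ , adm , 0<a′ , r₁ , (begin
      r₁ * r₁                                               ≡⟨ r₁² ⟩
      a * a + b * b                                         ≡⟨ cong₂ (λ x y → x * x + y * y) a≡a′ b≡b′ ⟩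
      a′ * a′ + b′ N X Y Z W s a′ * b′ N X Y Z W s a′       ≡⟨ proj₂ (npc-from-curve N X Y Z W s adm a′ 0<a′) ⟩
      (1ℚ + sq (kRatio N X Y Z W)) * (a′ * a′)              ∎)

  from : ∃RationalFaceDiagonal → ∃PerfectCuboid
  from (N , X , Y , Z , W , s , a , adm , 0<a , r , r²) =
    let (_ , 0<b , 0<c , _ , _ , _ , bc , ac , abc) , face = npc-from-curve N X Y Z W s adm a 0<a
    in a , b′ N X Y Z W s a , c′ N X Y Z W s a , 0<a , 0<b , 0<c ,
       (r , trans r² (sym face)) , (dbc′ N X Y Z W s a , sym bc) ,
       (dac′ N X Y Z W s a , sym ac) , (ds′ N X Y Z W s a , sym abc)

corollary2 :
  -- (i)
  (∀ N X Y Z W s → Admissible N X Y Z W s → ∀ a → 0ℚ < a →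
     IsNPC a (b′ N X Y Z W s a) (c′ N X Y Z W s a) (dbc′ N X Y Z W s a)
           (dac′ N X Y Z W s a) (ds′ N X Y Z W s a)
     × (a * a + b′ N X Y Z W s a * b′ N X Y Z W s a
          ≡ (1ℚ + sq (kRatio N X Y Z W)) * (a * a)))
  -- (ii)
  × (∀ a b c dbc dac ds → IsNPC a b c dbc dac ds →
       ∃ λ N → ∃ λ X → ∃ λ Y → ∃ λ Z → ∃ λ W → ∃ λ s → ∃ λ a′ →
         Admissible N X Y Z W s × (0ℚ < a′) ×
         (a ≡ a′) × (b ≡ b′ N X Y Z W s a′) × (c ≡ c′ N X Y Z W s a′) ×
         (dbc ≡ dbc′ N X Y Z W s a′) × (dac ≡ dac′ N X Y Z W s a′) ×
         (ds ≡ ds′ N X Y Z W s a′))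
  -- (iii)
  × ((∃ λ a → ∃ λ b → ∃ λ c → PerfectCuboid a b c) ⇔
     (∃ λ N → ∃ λ X → ∃ λ Y → ∃ λ Z → ∃ λ W → ∃ λ s → ∃ λ a′ →
        Admissible N X Y Z W s × (0ℚ < a′) ×
        IsRationalSquare ((1ℚ + sq (kRatio N X Y Z W)) * (a′ * a′))))
corollary2 = npc-from-curve , npc-to-curve , ∃PerfectCuboid⇔∃RationalFaceDiagonal
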